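{- For every $N\ge1$ and $m\ge1$, the value of $w^{St}_{\mathfrak{so}(N)}$ on the standard cycle $(1,2,\dots,m)$ (the permutation $1\mapsto2\mapsto\dots\mapsto m\mapsto1$) is $$w^{St}_{\mathfrak{so}(N)}((1,2,\dots,m))=\begin{cases}\dfrac{(N-1)^m+1-N}{N}, & m\text{ odd},\\[2mm] \dfrac{(N-1)^m-1+N^2}{N}, & m\text{ even}.\end{cases}$$
   Context: Let $E_{ij}$ ($1\le i,j\le N$) be the matrix units, $\bar i=N+1-i$, and $F_{ij}=E_{ij}-E_{\bar j\bar i}\in\mathfrak{so}(N)$. For $\alpha\in\mathbb{S}_m$ set $w_{\mathfrak{so}(N)}(\alpha)=\sum_{i_1,\dots,i_m=1}^NF_{i_1i_{\alpha(1)}}F_{i_2i_{\alpha(2)}}\cdots F_{i_mi_{\alpha(m)}}\in U(\mathfrak{so}(N))$, and let $w^{St}_{\mathfrak{so}(N)}(\alpha)$ be $\frac1N$ times the trace of the image of this element under the standard representation (sending $F_{ij}$ to the matrix $E_{ij}-E_{\bar j\bar i}$). -}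

module Defs where

open import Data.Nat as ℕ using (ℕ; zero; suc; _%_)
open import Data.Nat.DivMod using (m%n<n)
open import Data.Fin using (Fin; zero; suc; toℕ; fromℕ<; opposite; _≟_)
open import Data.Integer using (ℤ; +_; _+_; _*_; _-_; 0ℤ; 1ℤ)
open import Data.Vec.Functional using (_∷_)
open import Data.Bool using (if_then_else_; _∧_)
open import Relation.Nullary.Decidable using (⌊_⌋)
open import Data.Rational using (ℚ; _/_)

Mat : ℕ → Set
Mat N = Fin N → Fin N → ℤ

Σ-Fin : ∀ {n} → (Fin n → ℤ) → ℤ
Σ-Fin {zero}  f = 0ℤ
Σ-Fin {suc n} f = f zero + Σ-Fin (λ i → f (suc i))

Σ-Idx : ∀ {N} m → ((Fin m → Fin N) → ℤ) → ℤ
Σ-Idx zero    g = g (λ ())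
Σ-Idx (suc m) g = Σ-Fin (λ a → Σ-Idx m (λ rest → g (a ∷ rest)))

_+M_ : ∀ {N} → Mat N → Mat N → Mat N
(A +M B) a b = A a b + B a b

_·M_ : ∀ {N} → Mat N → Mat N → Mat N
(A ·M B) a c = Σ-Fin (λ b → A a b * B b c)

0M : ∀ {N} → Mat N
0M a b = 0ℤ

1M : ∀ {N} → Mat N
1M a b = if ⌊ a ≟ b ⌋ then 1ℤ else 0ℤ

ΣM : ∀ {N n} → (Fin n → Mat N) → Mat N
ΣM {n = zero}  f = 0M
ΣM {n = suc n} f = f zero +M ΣM (λ i → f (suc i))

ΠM : ∀ {N m} → (Fin m → Mat N) → Mat N
ΠM {m = zero}  f = 1M
ΠM {m = suc m} f = f zero ·M ΠM (λ i → f (suc i))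

trace : ∀ {N} → Mat N → ℤ
trace A = Σ-Fin (λ a → A a a)

E : ∀ {N} → Fin N → Fin N → Mat N
E i j a b = if ⌊ a ≟ i ⌋ ∧ ⌊ b ≟ j ⌋ then 1ℤ else 0ℤ

-- ī = N+1-i (0-based: opposite i = N-1-i)
bar : ∀ {N} → Fin N → Fin N
bar = opposite

-- Standard representation image of F_{ij} = E_{ij} - E_{j̄ ī}
F : ∀ {N} → Fin N → Fin N → Mat N
F i j a b = E i j a b - E (bar j) (bar i) a b

-- Image of w_{so(N)}(α) = Σ_{i₁..iₘ} F_{i₁ i_{α(1)}} ⋯ F_{iₘ i_{α(m)}} in the standard representation
wMat : ∀ N {m} → (Fin m → Fin m) → Mat N
wMat N {m} α a b = Σ-Idx m (λ i → ΠM (λ k → F (i k) (i (α k))) a b)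

wSt : ∀ N .{{_ : ℕ.NonZero N}} {m} → (Fin m → Fin m) → ℚ
wSt N α = trace (wMat N α) / N

-- standard cycle (1,2,…,m): in 0-based indices k ↦ (k+1) mod m
cycle : ∀ m .{{_ : ℕ.NonZero m}} → Fin m → Fin m
cycle m k = fromℕ< (m%n<n (suc (toℕ k)) m)

-- For the standard cycle, w is the sum of the closed walks F_{i₁ i₂} F_{i₂ i₃} ⋯ F_{iₘ i₁}.
-- In the standard representation the sum of all walks F_{s v₁} F_{v₁ v₂} ⋯ F_{vₙ t}
-- from s to t is a combination α E_{st} + β E_{t̄ s̄} + γ δ_{st} 1 of the three
-- so(N)-invariant tensors. Prepending a factor F_{s' s} and summing over s maps
-- (α, β, γ) to ((N − 1) α + β + γ, −γ, −β), starting from (1, −1, 0) for one factor.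
-- Closing the walk (t = s) and taking the trace gives N (α + β + N γ); along the
-- recursion (β, γ) alternates between (−1, 0) and (0, 1), and N α = (N − 1)^m ± 1.

module Submission where

open import Defs
open import Data.Nat using (ℕ; zero; suc; _%_; NonZero; s<s)
import Data.Nat.Properties as ℕP
open import Data.Nat.DivMod using ([m+n]%n≡m%n; n%n≡0; m<n⇒m%n≡m)
open import Data.Integer using (ℤ; +_; -_; _+_; _-_; _*_; _^_; 0ℤ; 1ℤ)
import Data.Integer.Properties as ℤP
open import Data.Integer.Tactic.RingSolver using (solve-∀)
open import Algebra.Properties.Semiring.Sum ℤP.+-*-semiring
  using (sum; sum-cong-≗; ∑-distrib-+; ∑-comm; *-distribˡ-sum)
open import Data.Rational using (_/_)
open import Data.Fin using (Fin; zero; suc; toℕ; fromℕ; inject₁; opposite; _≟_)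
open import Data.Fin.Properties
  using (toℕ-injective; toℕ-fromℕ<; toℕ-fromℕ; toℕ-inject₁; toℕ<n; suc-injective;
         opposite-involutive)
open import Data.Fin.Relation.Unary.Top using (view; ‵fromℕ; ‵inject₁)
open import Data.Vec.Functional using (_∷_; head; tail; insertAt)
open import Data.Vec.Functional.Properties using (insertAt-lookup)
open import Data.Product using (_×_; _,_)
open import Function using (_∘_; Injective)
open import Relation.Nullary using (yes; no; contradiction)
open import Relation.Binary.PropositionalEquality
  using (_≡_; _≢_; _≗_; refl; sym; trans; cong; cong₂; module ≡-Reasoning)
open ≡-Reasoning

δ : ∀ {n} → Fin n → Fin n → ℤ
δ x y = 1M x y

δ-refl : ∀ {n} (x : Fin n) → δ x x ≡ 1ℤ
δ-refl x with x ≟ x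
... | yes _   = refl
... | no x≢x = contradiction refl x≢x

δ-≢ : ∀ {n} {x y : Fin n} → x ≢ y → δ x y ≡ 0ℤ
δ-≢ {x = x} {y} x≢y with x ≟ y
... | yes x≡y = contradiction x≡y x≢y
... | no _    = refl

δ-sym : ∀ {n} (x y : Fin n) → δ x y ≡ δ y x
δ-sym x y with x ≟ y
... | yes refl = sym (δ-refl x)
... | no x≢y   = sym (δ-≢ (x≢y ∘ sym))

δ-idem : ∀ {n} (x y : Fin n) → δ x y * δ x y ≡ δ x y
δ-idem x y with x ≟ y
... | yes _ = refl
... | no _  = refl

δ-injective : ∀ {m n} {f : Fin m → Fin n} → Injective _≡_ _≡_ f →
              ∀ x y → δ (f x) (f y) ≡ δ x y
δ-injective {f = f} f-inj x y with x ≟ y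
... | yes refl = δ-refl (f x)
... | no x≢y   = δ-≢ (x≢y ∘ f-inj)

opposite-injective : ∀ {n} → Injective _≡_ _≡_ (opposite {n})
opposite-injective {x = x} {y} eq =
  trans (sym (opposite-involutive x)) (trans (cong opposite eq) (opposite-involutive y))

δ-opposite : ∀ {n} (x y : Fin n) → δ (opposite x) y ≡ δ x (opposite y)
δ-opposite x y = begin
  δ (opposite x) y
    ≡⟨ cong (δ (opposite x)) (opposite-involutive y) ⟨
  δ (opposite x) (opposite (opposite y))
    ≡⟨ δ-injective opposite-injective x (opposite y) ⟩
  δ x (opposite y) ∎

E-δ : ∀ {n} (i j a b : Fin n) → E i j a b ≡ δ a i * δ b j
E-δ i j a b with a ≟ i | b ≟ j
... | yes _ | yes _ = refl
... | yes _ | no _  = refl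
... | no _  | yes _ = refl
... | no _  | no _  = refl

Σ-Fin≡sum : ∀ {n} (f : Fin n → ℤ) → Σ-Fin f ≡ sum f
Σ-Fin≡sum {zero}  f = refl
Σ-Fin≡sum {suc n} f = cong (_+_ (f zero)) (Σ-Fin≡sum (f ∘ suc))

Σ-Fin-cong : ∀ {n} {f g : Fin n → ℤ} → f ≗ g → Σ-Fin f ≡ Σ-Fin g
Σ-Fin-cong {f = f} {g} f≗g
  rewrite Σ-Fin≡sum f | Σ-Fin≡sum g = sum-cong-≗ f≗g

Σ-Fin-+ : ∀ {n} (f g : Fin n → ℤ) → Σ-Fin (λ i → f i + g i) ≡ Σ-Fin f + Σ-Fin g
Σ-Fin-+ f g
  rewrite Σ-Fin≡sum (λ i → f i + g i) | Σ-Fin≡sum f | Σ-Fin≡sum g = ∑-distrib-+ f g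

Σ-Fin-*ˡ : ∀ {n} (k : ℤ) (f : Fin n → ℤ) → Σ-Fin (λ i → k * f i) ≡ k * Σ-Fin f
Σ-Fin-*ˡ k f
  rewrite Σ-Fin≡sum (λ i → k * f i) | Σ-Fin≡sum f = sym (*-distribˡ-sum k f)

Σ-Fin-neg : ∀ {n} (f : Fin n → ℤ) → Σ-Fin (λ i → - f i) ≡ - Σ-Fin f
Σ-Fin-neg {zero}  f = refl
Σ-Fin-neg {suc n} f =
  trans (cong (_+_ (- f zero)) (Σ-Fin-neg (f ∘ suc))) (sym (ℤP.neg-distrib-+ (f zero) _))

Σ-Fin-- : ∀ {n} (f g : Fin n → ℤ) → Σ-Fin (λ i → f i - g i) ≡ Σ-Fin f - Σ-Fin g
Σ-Fin-- f g = trans (Σ-Fin-+ f (λ i → - g i)) (cong (_+_ (Σ-Fin f)) (Σ-Fin-neg g))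

Σ-Fin-comm : ∀ {m n} (f : Fin m → Fin n → ℤ) →
             Σ-Fin (λ i → Σ-Fin (f i)) ≡ Σ-Fin (λ j → Σ-Fin (λ i → f i j))
Σ-Fin-comm f = begin
  Σ-Fin (λ i → Σ-Fin (f i))             ≡⟨ Σ-Fin≡sum² f ⟩
  sum (λ i → sum (f i))                 ≡⟨ ∑-comm f ⟩
  sum (λ j → sum (λ i → f i j))         ≡⟨ Σ-Fin≡sum² (λ j i → f i j) ⟨
  Σ-Fin (λ j → Σ-Fin (λ i → f i j))     ∎
  where
  Σ-Fin≡sum² : ∀ {m n} (g : Fin m → Fin n → ℤ) →
               Σ-Fin (λ i → Σ-Fin (g i)) ≡ sum (λ i → sum (g i))
  Σ-Fin≡sum² g =
    trans (Σ-Fin≡sum (λ i → Σ-Fin (g i))) (sum-cong-≗ (Σ-Fin≡sum ∘ g))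

Σ-Fin-const : ∀ n (k : ℤ) → Σ-Fin {n} (λ _ → k) ≡ + n * k
Σ-Fin-const zero    k = sym (ℤP.*-zeroˡ k)
Σ-Fin-const (suc n) k = trans (cong (_+_ k) (Σ-Fin-const n k)) (sym (ℤP.suc-* (+ n) k))

Σ-Fin-δ : ∀ {n} (c : Fin n) (f : Fin n → ℤ) → Σ-Fin (λ j → δ j c * f j) ≡ f c
Σ-Fin-δ {suc n} zero f = begin
  1ℤ * f zero + Σ-Fin (λ j → 0ℤ * f (suc j))
    ≡⟨ cong₂ _+_ (ℤP.*-identityˡ (f zero)) vanish ⟩
  f zero + 0ℤ
    ≡⟨ ℤP.+-identityʳ (f zero) ⟩
  f zero ∎
  where
  vanish : Σ-Fin (λ j → 0ℤ * f (suc j)) ≡ 0ℤ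
  vanish = trans (Σ-Fin-*ˡ 0ℤ (f ∘ suc)) (ℤP.*-zeroˡ (Σ-Fin (f ∘ suc)))
Σ-Fin-δ {suc n} (suc c) f = begin
  0ℤ * f zero + Σ-Fin (λ j → δ (suc j) (suc c) * f (suc j))
    ≡⟨ cong₂ _+_ (ℤP.*-zeroˡ (f zero))
                 (Σ-Fin-cong (λ j → cong (_* f (suc j)) (δ-injective suc-injective j c))) ⟩
  0ℤ + Σ-Fin (λ j → δ j c * f (suc j))
    ≡⟨ ℤP.+-identityˡ _ ⟩
  Σ-Fin (λ j → δ j c * f (suc j))
    ≡⟨ Σ-Fin-δ c (f ∘ suc) ⟩
  f (suc c) ∎

Σ-Idx-cong : ∀ {N} m {g h : (Fin m → Fin N) → ℤ} → g ≗ h → Σ-Idx m g ≡ Σ-Idx m h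
Σ-Idx-cong zero    g≗h = g≗h _
Σ-Idx-cong (suc m) g≗h = Σ-Fin-cong (λ a → Σ-Idx-cong m (λ r → g≗h (a ∷ r)))

Σ-Idx-*ˡ : ∀ {N} m (k : ℤ) (g : (Fin m → Fin N) → ℤ) →
           Σ-Idx m (λ r → k * g r) ≡ k * Σ-Idx m g
Σ-Idx-*ˡ zero    k g = refl
Σ-Idx-*ˡ (suc m) k g =
  trans (Σ-Fin-cong (λ a → Σ-Idx-*ˡ m k (g ∘ (a ∷_))))
        (Σ-Fin-*ˡ k (λ a → Σ-Idx m (g ∘ (a ∷_))))

Σ-Idx-Σ-Fin : ∀ {N n} m (h : Fin n → (Fin m → Fin N) → ℤ) →
              Σ-Idx m (λ r → Σ-Fin (λ x → h x r)) ≡ Σ-Fin (λ x → Σ-Idx m (h x))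
Σ-Idx-Σ-Fin zero    h = refl
Σ-Idx-Σ-Fin (suc m) h =
  trans (Σ-Fin-cong (λ a → Σ-Idx-Σ-Fin m (λ x r → h x (a ∷ r))))
        (Σ-Fin-comm (λ a x → Σ-Idx m (λ r → h x (a ∷ r))))

·M-identityʳ : ∀ {N} (A : Mat N) a b → (A ·M 1M) a b ≡ A a b
·M-identityʳ A a b =
  trans (Σ-Fin-cong (λ c → ℤP.*-comm (A a c) (δ c b))) (Σ-Fin-δ b (A a))

ΠM-cong : ∀ {N m} {f g : Fin m → Mat N} → (∀ k → f k ≡ g k) → ΠM f ≡ ΠM g
ΠM-cong {m = zero}  f≡g = refl
ΠM-cong {m = suc m} f≡g = cong₂ _·M_ (f≡g zero) (ΠM-cong (f≡g ∘ suc))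

Σ-Fin-E : ∀ {N} (i j a : Fin N) (Y : Fin N → ℤ) →
          Σ-Fin (λ c → E i j a c * Y c) ≡ δ a i * Y j
Σ-Fin-E i j a Y = begin
  Σ-Fin (λ c → E i j a c * Y c)
    ≡⟨ Σ-Fin-cong (λ c → trans (cong (_* Y c) (E-δ i j a c))
                               (ℤP.*-assoc (δ a i) (δ c j) (Y c))) ⟩
  Σ-Fin (λ c → δ a i * (δ c j * Y c))
    ≡⟨ Σ-Fin-*ˡ (δ a i) (λ c → δ c j * Y c) ⟩
  δ a i * Σ-Fin (λ c → δ c j * Y c)
    ≡⟨ cong (δ a i *_) (Σ-Fin-δ j Y) ⟩
  δ a i * Y j ∎

Σ-Fin-F : ∀ {N} (s a : Fin N) (X : Fin N → Fin N → ℤ) →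
          Σ-Fin (λ j → Σ-Fin (λ c → F s j a c * X j c)) ≡
          δ a s * Σ-Fin (λ j → X j j) - X (opposite a) (opposite s)
Σ-Fin-F s a X = begin
  Σ-Fin (λ j → Σ-Fin (λ c → F s j a c * X j c))
    ≡⟨ Σ-Fin-cong (λ j → trans (Σ-Fin-cong (λ c → *-distribʳ-- (E s j a c) _ (X j c)))
                               (Σ-Fin-- (λ c → E s j a c * X j c)
                                        (λ c → E (opposite j) s̄ a c * X j c))) ⟩
  Σ-Fin (λ j → Σ-Fin (λ c → E s j a c * X j c)
               - Σ-Fin (λ c → E (opposite j) s̄ a c * X j c))
    ≡⟨ Σ-Fin-cong (λ j → cong₂ _-_ (Σ-Fin-E s j a (X j))
                                   (Σ-Fin-E (opposite j) s̄ a (X j))) ⟩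
  Σ-Fin (λ j → δ a s * X j j - δ a (opposite j) * X j s̄)
    ≡⟨ Σ-Fin-- (λ j → δ a s * X j j) (λ j → δ a (opposite j) * X j s̄) ⟩
  Σ-Fin (λ j → δ a s * X j j) - Σ-Fin (λ j → δ a (opposite j) * X j s̄)
    ≡⟨ cong₂ _-_ (Σ-Fin-*ˡ (δ a s) (λ j → X j j))
                 (trans (Σ-Fin-cong reflect) (Σ-Fin-δ (opposite a) (λ j → X j s̄))) ⟩
  δ a s * Σ-Fin (λ j → X j j) - X (opposite a) s̄ ∎
  where
  s̄ = opposite s
  *-distribʳ-- : ∀ x y z → (x - y) * z ≡ x * z - y * z
  *-distribʳ-- = solve-∀
  reflect : ∀ j → δ a (opposite j) * X j s̄ ≡ δ j (opposite a) * X j s̄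
  reflect j = cong (_* X j s̄) (trans (δ-sym a (opposite j)) (δ-opposite j a))

-- walk v t = F_{v₀ v₁} F_{v₁ v₂} ⋯ F_{vₙ t}
walk : ∀ {N n} → (Fin (suc n) → Fin N) → Fin N → Mat N
walk {n = n} v t = ΠM (λ k → F (v k) (insertAt (tail v) (fromℕ n) t k))

cycle-fromℕ : ∀ n → cycle (suc n) (fromℕ n) ≡ zero
cycle-fromℕ n = toℕ-injective (begin
  toℕ (cycle (suc n) (fromℕ n)) ≡⟨ toℕ-fromℕ< _ ⟩
  suc (toℕ (fromℕ n)) % suc n   ≡⟨ cong (λ x → suc x % suc n) (toℕ-fromℕ n) ⟩
  suc n % suc n                 ≡⟨ n%n≡0 (suc n) ⟩
  0                             ∎)

cycle-inject₁ : ∀ {n} (j : Fin n) → cycle (suc n) (inject₁ j) ≡ suc j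
cycle-inject₁ {n} j = toℕ-injective (begin
  toℕ (cycle (suc n) (inject₁ j)) ≡⟨ toℕ-fromℕ< _ ⟩
  suc (toℕ (inject₁ j)) % suc n   ≡⟨ cong (λ x → suc x % suc n) (toℕ-inject₁ j) ⟩
  suc (toℕ j) % suc n             ≡⟨ m<n⇒m%n≡m (s<s (toℕ<n j)) ⟩
  suc (toℕ j)                     ∎)

insertAt-fromℕ-inject₁ : ∀ {a} {A : Set a} {n} (xs : Fin n → A) x (j : Fin n) →
                         insertAt xs (fromℕ n) x (inject₁ j) ≡ xs j
insertAt-fromℕ-inject₁ xs x zero    = refl
insertAt-fromℕ-inject₁ xs x (suc j) = insertAt-fromℕ-inject₁ (tail xs) x j

cycle-rotates : ∀ {a} {A : Set a} {n} (v : Fin (suc n) → A) k →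
                v (cycle (suc n) k) ≡ insertAt (tail v) (fromℕ n) (head v) k
cycle-rotates {n = n} v k with view k
... | ‵fromℕ =
  trans (cong v (cycle-fromℕ n)) (sym (insertAt-lookup (tail v) (fromℕ n) (head v)))
... | ‵inject₁ j =
  trans (cong v (cycle-inject₁ j)) (sym (insertAt-fromℕ-inject₁ (tail v) (head v) j))

cycle-product≡walk : ∀ {N n} (v : Fin (suc n) → Fin N) →
                     ΠM (λ k → F (v k) (v (cycle (suc n) k))) ≡ walk v (head v)
cycle-product≡walk v = ΠM-cong (λ k → cong (F (v k)) (cycle-rotates v k))

record Coeffs : Set where
  constructor ⟨_,_,_⟩
  field α β γ : ℤ
open Coeffs

-- tensor T s t = α E_{st} + β E_{t̄ s̄} + γ δ_{st} 1, the shape of the sum of walks s → t.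
tensor : ∀ {N} → Coeffs → Fin N → Fin N → Mat N
tensor T s t a b = α T * (δ a s * δ b t) + β T * (δ a (opposite t) * δ b (opposite s))
                 + γ T * (δ s t * δ a b)

step : ℕ → Coeffs → Coeffs
step N ⟨ α , β , γ ⟩ = ⟨ (+ N - 1ℤ) * α + β + γ , - γ , - β ⟩

coeffs : ℕ → ℕ → Coeffs
coeffs N zero    = ⟨ 1ℤ , - 1ℤ , 0ℤ ⟩
coeffs N (suc n) = step N (coeffs N n)

tensor-diagonal : ∀ {N} T (t b : Fin N) →
                  Σ-Fin (λ j → tensor T j t j b) ≡ (+ N * α T + β T + γ T) * δ b t
tensor-diagonal {N} T t b = begin
  Σ-Fin (λ j → tensor T j t j b)
    ≡⟨ Σ-Fin-cong summand ⟩
  Σ-Fin (λ j → α T * δ b t + (f j + g j))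
    ≡⟨ Σ-Fin-+ (λ _ → α T * δ b t) (λ j → f j + g j) ⟩
  Σ-Fin {N} (λ _ → α T * δ b t) + Σ-Fin (λ j → f j + g j)
    ≡⟨ cong₂ _+_ (Σ-Fin-const N (α T * δ b t)) (Σ-Fin-+ f g) ⟩
  + N * (α T * δ b t) + (Σ-Fin f + Σ-Fin g)
    ≡⟨ cong (_+_ (+ N * (α T * δ b t)))
            (cong₂ _+_ (Σ-Fin-δ t̄ (λ j → β T * δ b (opposite j)))
                       (Σ-Fin-δ t (λ j → γ T * δ j b))) ⟩
  + N * (α T * δ b t) + (β T * δ b (opposite t̄) + γ T * δ t b)
    ≡⟨ cong (_+_ (+ N * (α T * δ b t)))
            (cong₂ (λ x y → β T * x + γ T * y)
                   (cong (δ b) (opposite-involutive t)) (δ-sym t b)) ⟩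
  + N * (α T * δ b t) + (β T * δ b t + γ T * δ b t)
    ≡⟨ collect (+ N) (α T) (β T) (γ T) (δ b t) ⟩
  (+ N * α T + β T + γ T) * δ b t ∎
  where
  t̄ = opposite t
  f g : Fin N → ℤ
  f j = δ j t̄ * (β T * δ b (opposite j))
  g j = δ j t * (γ T * δ j b)
  reorder : ∀ α β γ d e f g h → α * (1ℤ * d) + β * (e * f) + γ * (g * h)
                              ≡ α * d + (e * (β * f) + g * (γ * h))
  reorder = solve-∀
  summand : ∀ j → tensor T j t j b ≡ α T * δ b t + (f j + g j)
  summand j = begin
    α T * (δ j j * δ b t) + β T * (δ j t̄ * δ b j̄) + γ T * (δ j t * δ j b)
      ≡⟨ cong (λ d → α T * (d * δ b t) + β T * (δ j t̄ * δ b j̄) + γ T * (δ j t * δ j b))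
              (δ-refl j) ⟩
    α T * (1ℤ * δ b t) + β T * (δ j t̄ * δ b j̄) + γ T * (δ j t * δ j b)
      ≡⟨ reorder (α T) (β T) (γ T) (δ b t) (δ j t̄) (δ b j̄) (δ j t) (δ j b) ⟩
    α T * δ b t + (f j + g j) ∎
    where j̄ = opposite j
  collect : ∀ n α β γ d → n * (α * d) + (β * d + γ * d) ≡ (n * α + β + γ) * d
  collect = solve-∀

tensor-opposite : ∀ {N} T (s t a b : Fin N) →
                  tensor T (opposite a) t (opposite s) b ≡ tensor ⟨ α T , γ T , β T ⟩ s t a b
tensor-opposite T s t a b = begin
  α T * (δ s̄ ā * δ b t) + β T * (δ s̄ t̄ * δ b (opposite ā)) + γ T * (δ ā t * δ s̄ b)
    ≡⟨ cong₂ _+_ (cong₂ _+_ (cong (λ x → α T * (x * δ b t))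
                                  (trans (δ-opposite² s a) (δ-sym s a)))
                            (cong₂ (λ x y → β T * (x * y)) (δ-opposite² s t)
                                   (trans (cong (δ b) (opposite-involutive a)) (δ-sym b a))))
                 (cong₂ (λ x y → γ T * (x * y)) (δ-opposite a t) (δ-sym s̄ b)) ⟩
  α T * (δ a s * δ b t) + β T * (δ s t * δ a b) + γ T * (δ a t̄ * δ b s̄)
    ≡⟨ swap-last (α T * (δ a s * δ b t)) (β T * (δ s t * δ a b)) (γ T * (δ a t̄ * δ b s̄)) ⟩
  α T * (δ a s * δ b t) + γ T * (δ a t̄ * δ b s̄) + β T * (δ s t * δ a b) ∎
  where
  s̄ = opposite s
  t̄ = opposite t
  ā = opposite a
  δ-opposite² = δ-injective opposite-injective
  swap-last : ∀ x y z → x + y + z ≡ x + z + y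
  swap-last = solve-∀

tensor-step : ∀ {N} T (s t a b : Fin N) →
              Σ-Fin (λ j → Σ-Fin (λ c → F s j a c * tensor T j t c b))
              ≡ tensor (step N T) s t a b
tensor-step {N} T s t a b = begin
  Σ-Fin (λ j → Σ-Fin (λ c → F s j a c * tensor T j t c b))
    ≡⟨ Σ-Fin-F s a (λ j c → tensor T j t c b) ⟩
  δ a s * Σ-Fin (λ j → tensor T j t j b) - tensor T (opposite a) t (opposite s) b
    ≡⟨ cong₂ (λ x y → δ a s * x - y)
             (tensor-diagonal T t b) (tensor-opposite T s t a b) ⟩
  δ a s * ((+ N * α T + β T + γ T) * δ b t) - tensor ⟨ α T , γ T , β T ⟩ s t a b
    ≡⟨ combine (+ N) (α T) (β T) (γ T) (δ a s) (δ b t)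
               (δ a (opposite t) * δ b (opposite s)) (δ s t * δ a b) ⟩
  tensor (step N T) s t a b ∎
  where
  combine : ∀ n α β γ x y u v →
            x * ((n * α + β + γ) * y) - (α * (x * y) + γ * u + β * v)
            ≡ ((n - 1ℤ) * α + β + γ) * (x * y) + (- γ) * u + (- β) * v
  combine = solve-∀

tensor-trace : ∀ {N} T (a : Fin N) →
               Σ-Fin (λ s → tensor T s s a a) ≡ α T + β T + + N * γ T
tensor-trace {N} T a = begin
  Σ-Fin (λ s → tensor T s s a a)
    ≡⟨ Σ-Fin-cong summand ⟩
  Σ-Fin (λ s → δ s a * α T + δ s (opposite a) * β T + γ T)
    ≡⟨ Σ-Fin-+ (λ s → δ s a * α T + δ s (opposite a) * β T) (λ _ → γ T) ⟩
  Σ-Fin (λ s → δ s a * α T + δ s (opposite a) * β T) + Σ-Fin {N} (λ _ → γ T)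
    ≡⟨ cong₂ _+_ (Σ-Fin-+ (λ s → δ s a * α T) (λ s → δ s (opposite a) * β T))
                 (Σ-Fin-const N (γ T)) ⟩
  Σ-Fin (λ s → δ s a * α T) + Σ-Fin (λ s → δ s (opposite a) * β T) + + N * γ T
    ≡⟨ cong (_+ + N * γ T)
            (cong₂ _+_ (Σ-Fin-δ a (λ _ → α T)) (Σ-Fin-δ (opposite a) (λ _ → β T))) ⟩
  α T + β T + + N * γ T ∎
  where
  reorder : ∀ α β γ x y → α * x + β * y + γ * (1ℤ * 1ℤ) ≡ x * α + y * β + γ
  reorder = solve-∀
  summand : ∀ s → tensor T s s a a ≡ δ s a * α T + δ s (opposite a) * β T + γ T
  summand s = trans (cong₂ _+_ (cong₂ _+_ (cong (α T *_) (trans (δ-idem a s) (δ-sym a s)))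
                                          (cong (β T *_) (trans (δ-idem a s̄) δ-a-s̄)))
                               (cong (γ T *_) (cong₂ _*_ (δ-refl s) (δ-refl a))))
                    (reorder (α T) (β T) (γ T) (δ s a) (δ s (opposite a)))
    where
    s̄ = opposite s
    δ-a-s̄ : δ a s̄ ≡ δ s (opposite a)
    δ-a-s̄ = trans (δ-sym a s̄) (δ-opposite s a)

walk-sum : ∀ {N} n (s t a b : Fin N) →
           Σ-Idx n (λ r → walk (s ∷ r) t a b) ≡ tensor (coeffs N n) s t a b
walk-sum {N} zero s t a b = begin
  (F s t ·M 1M) a b
    ≡⟨ ·M-identityʳ (F s t) a b ⟩
  E s t a b - E (opposite t) (opposite s) a b
    ≡⟨ cong₂ _-_ (E-δ s t a b) (E-δ (opposite t) (opposite s) a b) ⟩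
  δ a s * δ b t - δ a (opposite t) * δ b (opposite s)
    ≡⟨ as-tensor (δ a s * δ b t) (δ a (opposite t) * δ b (opposite s)) (δ s t * δ a b) ⟩
  tensor (coeffs N zero) s t a b ∎
  where
  as-tensor : ∀ x y z → x - y ≡ 1ℤ * x + (- 1ℤ) * y + 0ℤ * z
  as-tensor = solve-∀
walk-sum {N} (suc n) s t a b = begin
  Σ-Fin (λ j → Σ-Idx n (λ r → Σ-Fin (λ c → F s j a c * walk (j ∷ r) t c b)))
    ≡⟨ Σ-Fin-cong (λ j → Σ-Idx-Σ-Fin n (λ c r → F s j a c * walk (j ∷ r) t c b)) ⟩
  Σ-Fin (λ j → Σ-Fin (λ c → Σ-Idx n (λ r → F s j a c * walk (j ∷ r) t c b)))
    ≡⟨ Σ-Fin-cong (λ j → Σ-Fin-cong (λ c →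
         trans (Σ-Idx-*ˡ n (F s j a c) (λ r → walk (j ∷ r) t c b))
               (cong (F s j a c *_) (walk-sum n j t c b)))) ⟩
  Σ-Fin (λ j → Σ-Fin (λ c → F s j a c * tensor (coeffs N n) j t c b))
    ≡⟨ tensor-step (coeffs N n) s t a b ⟩
  tensor (coeffs N (suc n)) s t a b ∎

trace-cycle : ∀ N n → let T = coeffs N n in
              trace (wMat N (cycle (suc n))) ≡ + N * (α T + β T + + N * γ T)
trace-cycle N n = begin
  Σ-Fin {N} (λ a → Σ-Fin {N} (λ s → Σ-Idx n (λ r →
    ΠM (λ k → F ((s ∷ r) k) ((s ∷ r) (cycle (suc n) k))) a a)))
    ≡⟨ Σ-Fin-cong (λ a → Σ-Fin-cong (λ s → Σ-Idx-cong {N} n (λ r →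
         cong (λ M → M a a) (cycle-product≡walk (s ∷ r))))) ⟩
  Σ-Fin {N} (λ a → Σ-Fin {N} (λ s → Σ-Idx n (λ r → walk (s ∷ r) s a a)))
    ≡⟨ Σ-Fin-cong (λ a → Σ-Fin-cong (λ s → walk-sum {N} n s s a a)) ⟩
  Σ-Fin {N} (λ a → Σ-Fin {N} (λ s → tensor T s s a a))
    ≡⟨ Σ-Fin-cong (tensor-trace {N} T) ⟩
  Σ-Fin {N} (λ _ → α T + β T + + N * γ T)
    ≡⟨ Σ-Fin-const N (α T + β T + + N * γ T) ⟩
  + N * (α T + β T + + N * γ T) ∎
  where T = coeffs N n

%2-step : ∀ m → suc (suc m) % 2 ≡ m % 2
%2-step m = trans (cong (_% 2) (ℕP.+-comm 2 m)) ([m+n]%n≡m%n m 2)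

odd⇒pred-even : ∀ m → suc m % 2 ≡ 1 → m % 2 ≡ 0
even⇒pred-odd : ∀ m → suc m % 2 ≡ 0 → m % 2 ≡ 1
odd⇒pred-even zero          _ = refl
odd⇒pred-even (suc zero)    ()
odd⇒pred-even (suc (suc m)) h =
  trans (%2-step m) (odd⇒pred-even m (trans (sym (%2-step (suc m))) h))
even⇒pred-odd zero          ()
even⇒pred-odd (suc zero)    _ = refl
even⇒pred-odd (suc (suc m)) h =
  trans (%2-step m) (even⇒pred-odd m (trans (sym (%2-step (suc m))) h))

α-step : ∀ N T → + N * α (step N T) ≡ (+ N - 1ℤ) * (+ N * α T) + + N * (β T + γ T)
α-step N T = expand (+ N) (α T) (β T) (γ T)
  where
  expand : ∀ n α β γ →
           n * ((n - 1ℤ) * α + β + γ) ≡ (n - 1ℤ) * (n * α) + n * (β + γ)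
  expand = solve-∀

coeffs-odd  : ∀ N n → suc n % 2 ≡ 1 → let T = coeffs N n in
              β T ≡ - 1ℤ × γ T ≡ 0ℤ × + N * α T ≡ (+ N - 1ℤ) ^ suc n + 1ℤ
coeffs-even : ∀ N n → suc n % 2 ≡ 0 → let T = coeffs N n in
              β T ≡ 0ℤ × γ T ≡ 1ℤ × + N * α T ≡ (+ N - 1ℤ) ^ suc n - 1ℤ
coeffs-odd N zero _ = refl , refl , grow (+ N)
  where
  grow : ∀ n → n * 1ℤ ≡ (n - 1ℤ) * 1ℤ + 1ℤ
  grow = solve-∀
coeffs-odd N (suc n) h with coeffs-even N n (odd⇒pred-even (suc n) h)
... | β≡0 , γ≡1 , Nα≡ = cong -_ γ≡1 , cong -_ β≡0 , (begin
  + N * α (step N T)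
    ≡⟨ α-step N T ⟩
  (+ N - 1ℤ) * (+ N * α T) + + N * (β T + γ T)
    ≡⟨ cong₂ (λ x y → (+ N - 1ℤ) * x + + N * y) Nα≡ (cong₂ _+_ β≡0 γ≡1) ⟩
  (+ N - 1ℤ) * ((+ N - 1ℤ) ^ suc n - 1ℤ) + + N * (0ℤ + 1ℤ)
    ≡⟨ grow (+ N) ((+ N - 1ℤ) ^ suc n) ⟩
  (+ N - 1ℤ) ^ suc (suc n) + 1ℤ ∎)
  where
  T = coeffs N n
  grow : ∀ n p → (n - 1ℤ) * (p - 1ℤ) + n * (0ℤ + 1ℤ) ≡ (n - 1ℤ) * p + 1ℤ
  grow = solve-∀
coeffs-even N zero ()
coeffs-even N (suc n) h with coeffs-odd N n (even⇒pred-odd (suc n) h)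
... | β≡-1 , γ≡0 , Nα≡ = cong -_ γ≡0 , cong -_ β≡-1 , (begin
  + N * α (step N T)
    ≡⟨ α-step N T ⟩
  (+ N - 1ℤ) * (+ N * α T) + + N * (β T + γ T)
    ≡⟨ cong₂ (λ x y → (+ N - 1ℤ) * x + + N * y) Nα≡ (cong₂ _+_ β≡-1 γ≡0) ⟩
  (+ N - 1ℤ) * ((+ N - 1ℤ) ^ suc n + 1ℤ) + + N * (- 1ℤ + 0ℤ)
    ≡⟨ grow (+ N) ((+ N - 1ℤ) ^ suc n) ⟩
  (+ N - 1ℤ) ^ suc (suc n) - 1ℤ ∎)
  where
  T = coeffs N n
  grow : ∀ n p → (n - 1ℤ) * (p + 1ℤ) + n * (- 1ℤ + 0ℤ) ≡ (n - 1ℤ) * p - 1ℤ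
  grow = solve-∀

trace-cycle-odd : ∀ N n → suc n % 2 ≡ 1 →
                  trace (wMat N (cycle (suc n))) ≡ (+ N - + 1) ^ suc n + + 1 - + N
trace-cycle-odd N n h with coeffs-odd N n h
... | β≡-1 , γ≡0 , Nα≡ = begin
  trace (wMat N (cycle (suc n)))
    ≡⟨ trace-cycle N n ⟩
  + N * (α T + β T + + N * γ T)
    ≡⟨ cong₂ (λ x y → + N * (α T + x + + N * y)) β≡-1 γ≡0 ⟩
  + N * (α T + - 1ℤ + + N * 0ℤ)
    ≡⟨ simplify (+ N) (α T) ⟩
  + N * α T - + N
    ≡⟨ cong (_- + N) Nα≡ ⟩
  (+ N - 1ℤ) ^ suc n + 1ℤ - + N ∎
  where
  T = coeffs N n
  simplify : ∀ n α → n * (α + - 1ℤ + n * 0ℤ) ≡ n * α - n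
  simplify = solve-∀

trace-cycle-even : ∀ N n → suc n % 2 ≡ 0 →
                   trace (wMat N (cycle (suc n))) ≡ (+ N - + 1) ^ suc n - + 1 + (+ N) ^ 2
trace-cycle-even N n h with coeffs-even N n h
... | β≡0 , γ≡1 , Nα≡ = begin
  trace (wMat N (cycle (suc n)))
    ≡⟨ trace-cycle N n ⟩
  + N * (α T + β T + + N * γ T)
    ≡⟨ cong₂ (λ x y → + N * (α T + x + + N * y)) β≡0 γ≡1 ⟩
  + N * (α T + 0ℤ + + N * 1ℤ)
    ≡⟨ simplify (+ N) (α T) ⟩
  + N * α T + (+ N) ^ 2
    ≡⟨ cong (_+ (+ N) ^ 2) Nα≡ ⟩
  (+ N - 1ℤ) ^ suc n - 1ℤ + (+ N) ^ 2 ∎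
  where
  T = coeffs N n
  simplify : ∀ n α → n * (α + 0ℤ + n * 1ℤ) ≡ n * α + n * (n * 1ℤ)
  simplify = solve-∀

mainTheorem7 : (N m : ℕ) → .{{_ : NonZero N}} → .{{_ : NonZero m}} →
    ((m % 2 ≡ 1) → wSt N (cycle m) ≡ ((((+ N) - (+ 1)) ^ m + + 1 - + N) / N)) ×
    ((m % 2 ≡ 0) → wSt N (cycle m) ≡ ((((+ N) - (+ 1)) ^ m - + 1 + (+ N) ^ 2) / N))
mainTheorem7 N (suc n) = (λ odd → cong (_/ N) (trace-cycle-odd N n odd))
                       , (λ even → cong (_/ N) (trace-cycle-even N n even))
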